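{- Let $p$ be a binary word of length $l$ having $r$ runs, where $r \le 3$. For every $n \ge l$ there exists a binary word $w$ of length $n$ with exactly $r$ runs such that $c_p(w) = M_{n,p}$.
   Context: A binary word is a finite sequence over $\{0,1\}$. An occurrence of $p = p_1\cdots p_l$ in $w = w_1\cdots w_n$ is a choice of indices $1 \le i_1 < \cdots < i_l \le n$ with $w_{i_1}\cdots w_{i_l} = p$; $c_p(w)$ is the number of occurrences. $M_{n,p} = \max\{c_p(w) : w \in \{0,1\}^n\}$. A run of a word is a maximal block of consecutive equal letters. -}

module Defs where

open import Data.Bool using (Bool; true; false; if_then_else_)
open import Data.Bool.Properties using () renaming (_≟_ to _≟ᵇ_)
open import Data.Nat using (ℕ; zero; suc; _+_; _⊔_)
open import Data.List using (List; []; _∷_; length; map; _++_)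
open import Relation.Nullary using (does)

-- Binary words over {0,1}, encoded with Bool (false = 0, true = 1).
Word : Set
Word = List Bool

-- c p w : number of occurrences of p in w as a (scattered) subsequence,
-- i.e. number of index choices i₁ < ... < i_l with w_{i₁}...w_{i_l} = p.
-- Standard recursion on w: either the first letter of w is not used,
-- or it is used to match the first letter of p.
c : Word → Word → ℕ
c []      _       = 1
c (_ ∷ _) []      = 0
c (a ∷ p) (b ∷ w) = c (a ∷ p) w + (if does (a ≟ᵇ b) then c p w else 0)

allWords : ℕ → List Word
allWords zero    = [] ∷ []
allWords (suc n) = map (false ∷_) (allWords n) ++ map (true ∷_) (allWords n)

maxList : List ℕ → ℕ
maxList []       = 0
maxList (x ∷ xs) = x ⊔ maxList xs

M : ℕ → Word → ℕ
M n p = maxList (map (c p) (allWords n))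

runsFrom : Bool → Word → ℕ
runsFrom _ []      = 0
runsFrom a (b ∷ w) = (if does (a ≟ᵇ b) then 0 else 1) + runsFrom b w

runs : Word → ℕ
runs []      = 0
runs (a ∷ w) = suc (runsFrom a w)

-- A pattern with at most three runs is a^x, or o^x i^y o^z with x, y ≥ 1 and o ≠ i.
-- For a^x one has c_p(w) = C(#a(w), x), which is largest for w = a^n.
-- For o^x i^y o^z, reading w from left to right shows that w is dominated by a
-- block word o^a i^m o^k with the same letter counts: when an i is read, the
-- occurrences using it as the first i of the pattern and those not using it are
-- bounded by two products of binomials, and Pascal's rule lets both be absorbed by
-- whichever of the two candidate splittings of the o's gives the larger product.
-- Since c_p(o^a i^m o^k) = C(a,x) C(m,y) C(k,z), a maximizing block word has blocks
-- at least as long as those of p, hence as many runs as p; when z = 0 its trailing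
-- o's can moreover be moved to the front.
module Submission where

open import Defs
open import Data.Nat using (ℕ; _≤_)
open import Data.List using (length)
open import Data.Product using (Σ; _×_)
open import Relation.Binary.PropositionalEquality using (_≡_)

open import Data.Bool using (Bool; true; false)
open import Data.Bool.Properties using (¬-not) renaming (_≟_ to _≟ᵇ_)
open import Data.List using ([]; _∷_; map; _++_; replicate; filter)
open import Data.List.Properties using (++-identityʳ; length-++; length-replicate; length-filter)
open import Data.List.Membership.Propositional using (_∈_)
open import Data.List.Membership.Propositional.Properties using (∈-map⁺; ∈-map⁻; ∈-++⁺ˡ; ∈-++⁺ʳ; ∈-++⁻)
open import Data.List.Relation.Unary.Any using (here; there)
open import Data.Nat using (suc; zero; _+_; _*_; _∸_; _<_; z≤n; s≤s; z<s; _≤′_; ≤′-refl; ≤′-step)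
open import Data.Nat.Combinatorics using (_C_; nCk+nC[k+1]≡[n+1]C[k+1]; k>n⇒nCk≡0)
open import Data.Nat.Properties
open import Data.Nat.Tactic.RingSolver using (solve; solve-∀)
open import Data.Product using (_,_)
open import Data.Sum using (_⊎_; inj₁; inj₂)
open import Relation.Binary.PropositionalEquality using (refl; sym; trans; cong; cong₂; subst; _≢_; ≢-sym; module ≡-Reasoning)
open import Relation.Nullary using (yes; no; contradiction)

RunPreservingMaximizer : ℕ → Word → Set
RunPreservingMaximizer n p = Σ Word λ w → (length w ≡ n) × (runs w ≡ runs p) × (c p w ≡ M n p)

both-≢⇒≡ : ∀ {x y z : Bool} → x ≢ z → y ≢ z → x ≡ y
both-≢⇒≡ x≢z y≢z = trans (¬-not x≢z) (sym (¬-not y≢z))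

replicate-++-∷ : ∀ {A : Set} d (a : A) w → replicate d a ++ a ∷ w ≡ replicate (suc d) a ++ w
replicate-++-∷ zero    a w = refl
replicate-++-∷ (suc d) a w = cong (a ∷_) (replicate-++-∷ d a w)

C-pascal : ∀ n k → n C suc k + n C k ≡ suc n C suc k
C-pascal n k = trans (+-comm (n C suc k) (n C k)) (nCk+nC[k+1]≡[n+1]C[k+1] n k)

C-pascal-* : ∀ n k v → (n C suc k) * v + (n C k) * v ≡ (suc n C suc k) * v
C-pascal-* n k v = trans (sym (*-distribʳ-+ v (n C suc k) (n C k))) (cong (_* v) (C-pascal n k))

C-≤-suc : ∀ n k → n C k ≤ suc n C k
C-≤-suc n zero    = ≤-refl
C-≤-suc n (suc k) = subst (n C suc k ≤_) (C-pascal n k) (m≤m+n (n C suc k) (n C k))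

C-monoˡ-≤ : ∀ {m n} k → m ≤ n → m C k ≤ n C k
C-monoˡ-≤ {m} k m≤n = go (≤⇒≤′ m≤n)
  where
  go : ∀ {n} → m ≤′ n → m C k ≤ n C k
  go ≤′-refl        = ≤-refl
  go (≤′-step m≤′n) = ≤-trans (go m≤′n) (C-≤-suc _ k)

C-pos⇒≤ : ∀ n k → 0 < n C k → k ≤ n
C-pos⇒≤ n k pos with k ≤? n
... | yes k≤n = k≤n
... | no  k≰n = contradiction (subst (0 <_) (k>n⇒nCk≡0 (≰⇒> k≰n)) pos) (λ ())

*-pos⇒pos : ∀ u v → 0 < u * v → 0 < u × 0 < v
*-pos⇒pos (suc u) (suc v) _  = z<s , z<s
*-pos⇒pos (suc u) zero    uv = contradiction (subst (0 <_) (*-zeroʳ u) uv) (λ ())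

C*C*C-pos⇒≤ : ∀ {x y z} a m k → 0 < (a C x) * ((m C y) * (k C z)) → x ≤ a × y ≤ m × z ≤ k
C*C*C-pos⇒≤ {x} {y} {z} a m k pos with *-pos⇒pos (a C x) _ pos
... | a-pos , mk-pos with *-pos⇒pos (m C y) (k C z) mk-pos
...   | m-pos , k-pos = C-pos⇒≤ a x a-pos , C-pos⇒≤ m y m-pos , C-pos⇒≤ k z k-pos

+-*-regroup : ∀ a b p q v → (a + b * v) + (p + q * v) ≡ (a + p) + (b + q) * v
+-*-regroup = solve-∀

weighted-sum-≤ˡ : ∀ u v u′ v′ s t → u′ * v′ ≤ u * v →
                  u * (s * v) + u′ * (t * v′) ≤ u * ((s + t) * v)
weighted-sum-≤ˡ u v u′ v′ s t u′v′≤uv = begin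
  u * (s * v) + u′ * (t * v′)  ≡⟨ solve (u ∷ v ∷ u′ ∷ v′ ∷ s ∷ t ∷ []) ⟩
  s * (u * v) + t * (u′ * v′)  ≤⟨ +-monoʳ-≤ (s * (u * v)) (*-monoʳ-≤ t u′v′≤uv) ⟩
  s * (u * v) + t * (u * v)    ≡⟨ solve (u ∷ v ∷ s ∷ t ∷ []) ⟩
  u * ((s + t) * v)            ∎
  where open ≤-Reasoning

weighted-sum-≤ʳ : ∀ u v u′ v′ s t → u * v ≤ u′ * v′ →
                  u * (s * v) + u′ * (t * v′) ≤ u′ * ((s + t) * v′)
weighted-sum-≤ʳ u v u′ v′ s t uv≤u′v′ = begin
  u * (s * v) + u′ * (t * v′)  ≡⟨ +-comm (u * (s * v)) (u′ * (t * v′)) ⟩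
  u′ * (t * v′) + u * (s * v)  ≤⟨ weighted-sum-≤ˡ u′ v′ u v t s uv≤u′v′ ⟩
  u′ * ((t + s) * v′)          ≡⟨ cong (λ e → u′ * (e * v′)) (+-comm t s) ⟩
  u′ * ((s + t) * v′)          ∎
  where open ≤-Reasoning

better-split : ∀ {N A m} x y z d {a} → a ≤ A →
  N ≤ ((d + a) C x) * ((m C suc y) * ((A ∸ a) C z)) + (d C x) * ((m C y) * (A C z)) →
  Σ ℕ λ a′ → a′ ≤ A × N ≤ ((d + a′) C x) * ((suc m C suc y) * ((A ∸ a′) C z))
better-split {N} {A} {m} x y z d {a} a≤A N≤ with ≤-total ((d C x) * (A C z)) (((d + a) C x) * ((A ∸ a) C z))
... | inj₁ keep-a = a , a≤A , ≤-trans N≤ (≤-trans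
        (weighted-sum-≤ˡ ((d + a) C x) ((A ∸ a) C z) (d C x) (A C z) (m C suc y) (m C y) keep-a)
        (≤-reflexive (cong (λ e → ((d + a) C x) * (e * ((A ∸ a) C z))) (C-pascal m y))))
... | inj₂ reset = 0 , z≤n , ≤-trans N≤ (≤-trans
        (weighted-sum-≤ʳ ((d + a) C x) ((A ∸ a) C z) (d C x) (A C z) (m C suc y) (m C y) reset)
        (≤-reflexive (cong₂ (λ d′ e → (d′ C x) * (e * (A C z))) (sym (+-identityʳ d)) (C-pascal m y))))

c-∷-≡ : ∀ a p w → c (a ∷ p) (a ∷ w) ≡ c (a ∷ p) w + c p w
c-∷-≡ false p w = refl
c-∷-≡ true  p w = refl

c-∷-≢ : ∀ {a b} p w → a ≢ b → c (a ∷ p) (b ∷ w) ≡ c (a ∷ p) w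
c-∷-≢ {false} {false} p w a≢b = contradiction refl a≢b
c-∷-≢ {false} {true}  p w _   = +-identityʳ _
c-∷-≢ {true}  {false} p w _   = +-identityʳ _
c-∷-≢ {true}  {true}  p w a≢b = contradiction refl a≢b

c-self-++-pos : ∀ p u → 0 < c p (p ++ u)
c-self-++-pos []      u = z<s
c-self-++-pos (a ∷ p) u =
  subst (0 <_) (sym (c-∷-≡ a p (p ++ u))) (≤-trans (c-self-++-pos p u) (m≤n+m _ _))

count : Bool → Word → ℕ
count a w = length (filter (a ≟ᵇ_) w)

count-∷-≡ : ∀ a w → count a (a ∷ w) ≡ suc (count a w)
count-∷-≡ false w = refl
count-∷-≡ true  w = refl

count-∷-≢ : ∀ {a b} w → a ≢ b → count a (b ∷ w) ≡ count a w
count-∷-≢ {false} {false} w a≢b = contradiction refl a≢b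
count-∷-≢ {false} {true}  w _   = refl
count-∷-≢ {true}  {false} w _   = refl
count-∷-≢ {true}  {true}  w a≢b = contradiction refl a≢b

count-replicate : ∀ a k → count a (replicate k a) ≡ k
count-replicate a zero    = refl
count-replicate a (suc k) = trans (count-∷-≡ a (replicate k a)) (cong suc (count-replicate a k))

c-replicate : ∀ a z w → c (replicate z a) w ≡ count a w C z
c-replicate a zero    w       = refl
c-replicate a (suc z) []      = refl
c-replicate a (suc z) (b ∷ w) with b ≟ᵇ a
... | yes refl
  rewrite c-∷-≡ a (replicate z a) w | count-∷-≡ a w | c-replicate a (suc z) w | c-replicate a z w
  = C-pascal (count a w) z
... | no b≢a
  rewrite c-∷-≢ (replicate z a) w (≢-sym b≢a) | count-∷-≢ w (≢-sym b≢a)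
  = c-replicate a (suc z) w

runsFrom-∷-≡ : ∀ a w → runsFrom a (a ∷ w) ≡ runsFrom a w
runsFrom-∷-≡ false w = refl
runsFrom-∷-≡ true  w = refl

runsFrom-∷-≢ : ∀ {a b} w → a ≢ b → runsFrom a (b ∷ w) ≡ suc (runsFrom b w)
runsFrom-∷-≢ {false} {false} w a≢b = contradiction refl a≢b
runsFrom-∷-≢ {false} {true}  w _   = refl
runsFrom-∷-≢ {true}  {false} w _   = refl
runsFrom-∷-≢ {true}  {true}  w a≢b = contradiction refl a≢b

runsFrom-replicate-++ : ∀ a k w → runsFrom a (replicate k a ++ w) ≡ runsFrom a w
runsFrom-replicate-++ a zero    w = refl
runsFrom-replicate-++ a (suc k) w =
  trans (runsFrom-∷-≡ a (replicate k a ++ w)) (runsFrom-replicate-++ a k w)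

runs-replicate : ∀ a k → runs (replicate (suc k) a) ≡ 1
runs-replicate a k = cong suc (begin
  runsFrom a (replicate k a)       ≡⟨ cong (runsFrom a) (sym (++-identityʳ (replicate k a))) ⟩
  runsFrom a (replicate k a ++ []) ≡⟨ runsFrom-replicate-++ a k [] ⟩
  0                                ∎)
  where open ≡-Reasoning

runs-replicate-++ : ∀ {a b} k r → b ≢ a → runs (replicate (suc k) a ++ b ∷ r) ≡ suc (runs (b ∷ r))
runs-replicate-++ {a} k r b≢a =
  cong suc (trans (runsFrom-replicate-++ a k (_ ∷ r)) (runsFrom-∷-≢ r (≢-sym b≢a)))

data FirstRun (a : Bool) : Word → Set where
  whole : ∀ k → FirstRun a (replicate (suc k) a)
  split : ∀ k {b} r → b ≢ a → FirstRun a (replicate (suc k) a ++ b ∷ r)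

firstRun : ∀ a w → FirstRun a (a ∷ w)
firstRun a []      = whole 0
firstRun a (b ∷ w) with b ≟ᵇ a
... | no b≢a = split 0 w b≢a
... | yes refl with firstRun a w
...   | whole k       = whole (suc k)
...   | split k r b≢a = split (suc k) r b≢a

data AtMostThreeRuns : Word → Set where
  one-run     : ∀ a x → AtMostThreeRuns (replicate (suc x) a)
  two-letters : ∀ {o i} → o ≢ i → ∀ x y z →
                AtMostThreeRuns (replicate (suc x) o ++ replicate (suc y) i ++ replicate z o)

atMostThreeRuns : ∀ p → 0 < length p → runs p ≤ 3 → AtMostThreeRuns p
atMostThreeRuns (a ∷ w) _ runs≤3 with firstRun a w
... | whole x = one-run a x
... | split x {b} r b≢a with firstRun b r
...   | whole y = subst AtMostThreeRuns (cong (replicate (suc x) a ++_) (++-identityʳ _))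
                    (two-letters (≢-sym b≢a) x y 0)
...   | split y r′ c≢b with both-≢⇒≡ c≢b (≢-sym b≢a)
...     | refl with firstRun a r′
...       | whole z = two-letters (≢-sym b≢a) x y (suc z)
...       | split z {d} r″ d≢a = contradiction (subst (_≤ 3) four-runs runs≤3) (λ { (s≤s (s≤s (s≤s ()))) })
  where
  open ≡-Reasoning
  four-runs : runs (replicate (suc x) a ++ b ∷ replicate y b ++ a ∷ replicate z a ++ d ∷ r″)
            ≡ 3 + runs (d ∷ r″)
  four-runs = begin
    runs (replicate (suc x) a ++ b ∷ replicate y b ++ a ∷ replicate z a ++ d ∷ r″)
      ≡⟨ runs-replicate-++ x _ b≢a ⟩
    suc (runs (replicate (suc y) b ++ a ∷ replicate z a ++ d ∷ r″))
      ≡⟨ cong suc (runs-replicate-++ y _ c≢b) ⟩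
    2 + runs (replicate (suc z) a ++ d ∷ r″)
      ≡⟨ cong (2 +_) (runs-replicate-++ z r″ d≢a) ⟩
    3 + runs (d ∷ r″)
      ∎

allWords-complete : ∀ w → w ∈ allWords (length w)
allWords-complete []          = here refl
allWords-complete (false ∷ w) = ∈-++⁺ˡ (∈-map⁺ (false ∷_) (allWords-complete w))
allWords-complete (true ∷ w)  =
  ∈-++⁺ʳ (map (false ∷_) (allWords (length w))) (∈-map⁺ (true ∷_) (allWords-complete w))

allWords-length : ∀ n {w} → w ∈ allWords n → length w ≡ n
allWords-length zero    (here refl) = refl
allWords-length (suc n) w∈ with ∈-++⁻ (map (false ∷_) (allWords n)) w∈
... | inj₁ w∈₀ with ∈-map⁻ (false ∷_) w∈₀
...   | v , v∈ , refl = cong suc (allWords-length n v∈)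
allWords-length (suc n) w∈ | inj₂ w∈₁ with ∈-map⁻ (true ∷_) w∈₁
...   | v , v∈ , refl = cong suc (allWords-length n v∈)

maxList-upper : ∀ {x} xs → x ∈ xs → x ≤ maxList xs
maxList-upper (y ∷ xs) (here refl) = m≤m⊔n y (maxList xs)
maxList-upper (y ∷ xs) (there x∈)  = ≤-trans (maxList-upper xs x∈) (m≤n⊔m y (maxList xs))

maxList-∷-∈ : ∀ y ys → maxList (y ∷ ys) ∈ y ∷ ys
maxList-∷-∈ y []       = here (⊔-identityʳ y)
maxList-∷-∈ y (z ∷ zs) with ⊔-sel y (maxList (z ∷ zs))
... | inj₁ eq = here eq
... | inj₂ eq = there (subst (_∈ z ∷ zs) (sym eq) (maxList-∷-∈ z zs))

maxList-∈ : ∀ {x} xs → x ∈ xs → maxList xs ∈ xs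
maxList-∈ (y ∷ ys) _ = maxList-∷-∈ y ys

c-≤-M : ∀ p {w : Word} {n} → length w ≡ n → c p w ≤ M n p
c-≤-M p {w} refl = maxList-upper (map (c p) (allWords (length w))) (∈-map⁺ (c p) (allWords-complete w))

M-attained : ∀ p (w : Word) {n} → length w ≡ n → Σ Word λ ws → (length ws ≡ n) × (c p ws ≡ M n p)
M-attained p w {n} refl with ∈-map⁻ (c p) (maxList-∈ _ (∈-map⁺ (c p) (allWords-complete w)))
... | ws , ws∈ , M≡ = ws , allWords-length n ws∈ , sym M≡

M-pos : ∀ p {n} → length p ≤ n → 0 < M n p
M-pos p {n} p≤n = ≤-trans (c-self-++-pos p padding) (c-≤-M p padded-length)
  where
  padding = replicate (n ∸ length p) false
  padded-length : length (p ++ padding) ≡ n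
  padded-length = trans (length-++ p) (trans (cong (length p +_) (length-replicate (n ∸ length p)))
                                             (m+[n∸m]≡n p≤n))

maximizer-if-dominates : ∀ p {n} ws b → length b ≡ n → c p ws ≡ M n p → c p ws ≤ c p b → c p b ≡ M n p
maximizer-if-dominates p ws b len-b ws-max ws≤b = ≤-antisym (c-≤-M p len-b) (subst (_≤ _) ws-max ws≤b)

-- One run

c-replicate-≤ : ∀ a k {n} ws → length ws ≡ n → c (replicate k a) ws ≤ c (replicate k a) (replicate n a)
c-replicate-≤ a k {n} ws refl = begin
  c (replicate k a) ws               ≡⟨ c-replicate a k ws ⟩
  count a ws C k                     ≤⟨ C-monoˡ-≤ k (length-filter (a ≟ᵇ_) ws) ⟩
  length ws C k                      ≡⟨ cong (_C k) (sym (count-replicate a (length ws))) ⟩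
  count a (replicate n a) C k        ≡⟨ sym (c-replicate a k (replicate n a)) ⟩
  c (replicate k a) (replicate n a)  ∎
  where open ≤-Reasoning

one-run-maximizer : ∀ a x n → length (replicate (suc x) a) ≤ n → RunPreservingMaximizer n (replicate (suc x) a)
one-run-maximizer a x zero    ()
one-run-maximizer a x (suc n) _ with M-attained (replicate (suc x) a) (replicate (suc n) a) (length-replicate (suc n))
... | ws , ws-len , ws-max =
  replicate (suc n) a , length-replicate (suc n) , trans (runs-replicate a n) (sym (runs-replicate a x)) ,
  maximizer-if-dominates (replicate (suc x) a) ws (replicate (suc n) a) (length-replicate (suc n))
    ws-max (c-replicate-≤ a (suc x) ws ws-len)

-- Two letters

module TwoLetters {o i : Bool} (o≢i : o ≢ i) where

  i≢o : i ≢ o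
  i≢o = ≢-sym o≢i

  letter : ∀ b → b ≡ o ⊎ b ≡ i
  letter b with b ≟ᵇ o
  ... | yes b≡o = inj₁ b≡o
  ... | no  b≢o = inj₂ (both-≢⇒≡ b≢o i≢o)

  block : ℕ → ℕ → ℕ → Word
  block a m k = replicate a o ++ replicate m i ++ replicate k o

  length≡count+count : ∀ w → length w ≡ count o w + count i w
  length≡count+count []      = refl
  length≡count+count (b ∷ w) with letter b
  ... | inj₁ refl rewrite count-∷-≡ o w | count-∷-≢ w i≢o = cong suc (length≡count+count w)
  ... | inj₂ refl rewrite count-∷-≢ w o≢i | count-∷-≡ i w =
    trans (cong suc (length≡count+count w)) (sym (+-suc (count o w) (count i w)))

  length-block : ∀ a m k → length (block a m k) ≡ a + m + k
  length-block a m k = begin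
    length (block a m k)                                              ≡⟨ length-++ (replicate a o) ⟩
    length (replicate a o) + length (replicate m i ++ replicate k o)  ≡⟨ cong₂ _+_ (length-replicate a) length-tail ⟩
    a + (m + k)                                                       ≡⟨ sym (+-assoc a m k) ⟩
    a + m + k                                                         ∎
    where
    open ≡-Reasoning
    length-tail : length (replicate m i ++ replicate k o) ≡ m + k
    length-tail = trans (length-++ (replicate m i)) (cong₂ _+_ (length-replicate m) (length-replicate k))

  runs-block₂ : ∀ a m → runs (block (suc a) (suc m) 0) ≡ 2
  runs-block₂ a m = begin
    runs (block (suc a) (suc m) 0)          ≡⟨ runs-replicate-++ a (replicate m i ++ []) i≢o ⟩
    suc (runs (replicate (suc m) i ++ []))  ≡⟨ cong (λ w → suc (runs w)) (++-identityʳ (replicate (suc m) i)) ⟩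
    suc (runs (replicate (suc m) i))        ≡⟨ cong suc (runs-replicate i m) ⟩
    2                                       ∎
    where open ≡-Reasoning

  runs-block₃ : ∀ a m k → runs (block (suc a) (suc m) (suc k)) ≡ 3
  runs-block₃ a m k = begin
    runs (block (suc a) (suc m) (suc k))                   ≡⟨ runs-replicate-++ a (replicate m i ++ replicate (suc k) o) i≢o ⟩
    suc (runs (replicate (suc m) i ++ replicate (suc k) o)) ≡⟨ cong suc (runs-replicate-++ m (replicate k o) o≢i) ⟩
    2 + runs (replicate (suc k) o)                           ≡⟨ cong (2 +_) (runs-replicate o k) ⟩
    3                                                        ∎
    where open ≡-Reasoning

  count-o-block : ∀ m k → count o (replicate m i ++ replicate k o) ≡ k
  count-o-block zero    k = count-replicate o k
  count-o-block (suc m) k = trans (count-∷-≢ (replicate m i ++ replicate k o) o≢i) (count-o-block m k)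

  c-needs-i : ∀ x q k → c (replicate x o ++ i ∷ q) (replicate k o) ≡ 0
  c-needs-i zero    q zero    = refl
  c-needs-i (suc x) q zero    = refl
  c-needs-i zero    q (suc k) = trans (c-∷-≢ q (replicate k o) i≢o) (c-needs-i zero q k)
  c-needs-i (suc x) q (suc k) rewrite c-∷-≡ o (replicate x o ++ i ∷ q) (replicate k o)
    | c-needs-i (suc x) q k | c-needs-i x q k = refl

  c-needs-o-before-i : ∀ x q m k → c (replicate (suc x) o ++ i ∷ q) (replicate m i ++ replicate k o) ≡ 0
  c-needs-o-before-i x q zero    k = c-needs-i (suc x) q k
  c-needs-o-before-i x q (suc m) k =
    trans (c-∷-≢ (replicate x o ++ i ∷ q) (replicate m i ++ replicate k o) o≢i) (c-needs-o-before-i x q m k)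

  c-i^o^-i^o^ : ∀ y z m k → c (replicate y i ++ replicate z o) (replicate m i ++ replicate k o) ≡ (m C y) * (k C z)
  c-i^o^-i^o^ zero    z m       k rewrite c-replicate o z (replicate m i ++ replicate k o) | count-o-block m k =
    sym (*-identityˡ (k C z))
  c-i^o^-i^o^ (suc y) z zero    k = c-needs-i zero (replicate y i ++ replicate z o) k
  c-i^o^-i^o^ (suc y) z (suc m) k
    rewrite c-∷-≡ i (replicate y i ++ replicate z o) (replicate m i ++ replicate k o)
          | c-i^o^-i^o^ (suc y) z m k | c-i^o^-i^o^ y z m k = C-pascal-* m y (k C z)

  c-o^-prefix : ∀ x q a m k → c (replicate x o ++ i ∷ q) (block a m k) ≡ (a C x) * c (i ∷ q) (replicate m i ++ replicate k o)
  c-o^-prefix zero    q zero    m k = sym (*-identityˡ _)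
  c-o^-prefix (suc x) q zero    m k = c-needs-o-before-i x q m k
  c-o^-prefix zero    q (suc a) m k = trans (c-∷-≢ q (block a m k) i≢o) (c-o^-prefix zero q a m k)
  c-o^-prefix (suc x) q (suc a) m k rewrite c-∷-≡ o (replicate x o ++ i ∷ q) (block a m k)
    | c-o^-prefix (suc x) q a m k | c-o^-prefix x q a m k = C-pascal-* a x _

  c-block : ∀ x y z a m k → c (block x (suc y) z) (block a m k) ≡ (a C x) * ((m C suc y) * (k C z))
  c-block x y z a m k = trans (c-o^-prefix x (replicate y i ++ replicate z o) a m k)
                              (cong ((a C x) *_) (c-i^o^-i^o^ (suc y) z m k))

  c-i^o^-≤ : ∀ y z w → c (replicate y i ++ replicate z o) w ≤ (count i w C y) * (count o w C z)
  c-i^o^-≤ zero    z w       = ≤-reflexive (trans (c-replicate o z w) (sym (*-identityˡ _)))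
  c-i^o^-≤ (suc y) z []      = z≤n
  c-i^o^-≤ (suc y) z (b ∷ w) with letter b
  ... | inj₁ refl rewrite c-∷-≢ (replicate y i ++ replicate z o) w i≢o | count-∷-≢ w i≢o | count-∷-≡ o w =
    ≤-trans (c-i^o^-≤ (suc y) z w) (*-monoʳ-≤ (count i w C suc y) (C-≤-suc (count o w) z))
  ... | inj₂ refl rewrite c-∷-≡ i (replicate y i ++ replicate z o) w | count-∷-≡ i w | count-∷-≢ w o≢i =
    ≤-trans (+-mono-≤ (c-i^o^-≤ (suc y) z w) (c-i^o^-≤ y z w)) (≤-reflexive (C-pascal-* (count i w) y _))

  c-split-first-i : ∀ x q d w → c (replicate x o ++ i ∷ q) (replicate d o ++ i ∷ w)
                              ≡ c (replicate x o ++ i ∷ q) (replicate d o ++ w) + (d C x) * c q w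
  c-split-first-i zero    q zero    w = trans (c-∷-≡ i q w) (cong (c (i ∷ q) w +_) (sym (*-identityˡ (c q w))))
  c-split-first-i (suc x) q zero    w = trans (c-∷-≢ (replicate x o ++ i ∷ q) w o≢i) (sym (+-identityʳ _))
  c-split-first-i zero    q (suc d) w
    rewrite c-∷-≢ q (replicate d o ++ i ∷ w) i≢o | c-∷-≢ q (replicate d o ++ w) i≢o = c-split-first-i zero q d w
  c-split-first-i (suc x) q (suc d) w
    rewrite c-∷-≡ o (replicate x o ++ i ∷ q) (replicate d o ++ i ∷ w)
          | c-∷-≡ o (replicate x o ++ i ∷ q) (replicate d o ++ w)
          | c-split-first-i (suc x) q d w | c-split-first-i x q d w
          | sym (C-pascal d x)
    = +-*-regroup (c (replicate (suc x) o ++ i ∷ q) (replicate d o ++ w)) (d C suc x)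
                  (c (replicate x o ++ i ∷ q) (replicate d o ++ w)) (d C x) (c q w)

  dominated-after : ∀ x y z d w → Σ ℕ λ a → a ≤ count o w ×
    c (block x (suc y) z) (replicate d o ++ w) ≤ ((d + a) C x) * ((count i w C suc y) * ((count o w ∸ a) C z))
  dominated-after x y z d [] =
    0 , z≤n , ≤-trans (≤-reflexive (trans (cong (c p) (++-identityʳ (replicate d o))) (c-needs-i x q d))) z≤n
    where
    q = replicate y i ++ replicate z o
    p = replicate x o ++ i ∷ q
  dominated-after x y z d (b ∷ w) with letter b
  ... | inj₁ refl with dominated-after x y z (suc d) w
  ...   | a , a≤ , bound rewrite replicate-++-∷ d o w | count-∷-≡ o w | count-∷-≢ w i≢o =
    suc a , s≤s a≤ , ≤-trans bound (≤-reflexive (cong (λ e → (e C x) * ((count i w C suc y) * ((count o w ∸ a) C z))) (sym (+-suc d a))))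
  dominated-after x y z d (b ∷ w) | inj₂ refl with dominated-after x y z d w
  ...   | a , a≤ , bound
    rewrite c-split-first-i x (replicate y i ++ replicate z o) d w | count-∷-≢ w o≢i | count-∷-≡ i w =
    better-split x y z d a≤ (+-mono-≤ bound (*-monoʳ-≤ (d C x) (c-i^o^-≤ y z w)))

  dominated : ∀ x y z w → Σ ℕ λ a → a ≤ count o w ×
    c (block x (suc y) z) w ≤ c (block x (suc y) z) (block a (count i w) (count o w ∸ a))
  dominated x y z w with dominated-after x y z 0 w
  ... | a , a≤ , bound =
    a , a≤ , subst (c (block x (suc y) z) w ≤_) (sym (c-block x y z a (count i w) (count o w ∸ a))) bound

  block-maximizer : ∀ x y z n → length (block x (suc y) z) ≤ n →
    Σ ℕ λ a → Σ ℕ λ m → Σ ℕ λ k → (length (block a m k) ≡ n)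
      × (c (block x (suc y) z) (block a m k) ≡ M n (block x (suc y) z)) × x ≤ a × suc y ≤ m × z ≤ k
  block-maximizer x y z n p≤n with M-attained (block x (suc y) z) (replicate n o) (length-replicate n)
  ... | ws , ws-len , ws-max with dominated x y z ws
  ...   | a , a≤ , ws≤b =
    a , m , Z ∸ a , b-len , b-max , C*C*C-pos⇒≤ a m (Z ∸ a) b-pos
    where
    open ≡-Reasoning
    p = block x (suc y) z
    Z = count o ws
    m = count i ws
    b-len : length (block a m (Z ∸ a)) ≡ n
    b-len = begin
      length (block a m (Z ∸ a))  ≡⟨ length-block a m (Z ∸ a) ⟩
      a + m + (Z ∸ a)             ≡⟨ +-assoc a m (Z ∸ a) ⟩
      a + (m + (Z ∸ a))           ≡⟨ cong (a +_) (+-comm m (Z ∸ a)) ⟩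
      a + ((Z ∸ a) + m)           ≡⟨ sym (+-assoc a (Z ∸ a) m) ⟩
      a + (Z ∸ a) + m             ≡⟨ cong (_+ m) (m+[n∸m]≡n a≤) ⟩
      Z + m                       ≡⟨ sym (length≡count+count ws) ⟩
      length ws                   ≡⟨ ws-len ⟩
      n                           ∎
    b-max : c p (block a m (Z ∸ a)) ≡ M n p
    b-max = maximizer-if-dominates p ws (block a m (Z ∸ a)) b-len ws-max ws≤b
    b-pos : 0 < (a C x) * ((m C suc y) * ((Z ∸ a) C z))
    b-pos = subst (0 <_) (trans (sym b-max) (c-block x y z a m (Z ∸ a))) (M-pos p p≤n)

  c-merge-trailing : ∀ x y a m k → c (block x (suc y) 0) (block a m k) ≤ c (block x (suc y) 0) (block (a + k) m 0)
  c-merge-trailing x y a m k rewrite c-block x y 0 a m k | c-block x y 0 (a + k) m 0 =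
    *-monoˡ-≤ ((m C suc y) * 1) (C-monoˡ-≤ x (m≤m+n a k))

  maximizer : ∀ x y z n → length (block (suc x) (suc y) z) ≤ n → RunPreservingMaximizer n (block (suc x) (suc y) z)
  maximizer x y zero n p≤n with block-maximizer (suc x) y 0 n p≤n
  ... | suc a , suc m , k , b-len , b-max , s≤s _ , s≤s _ , _ =
    block (suc a + k) (suc m) 0 , merged-len , trans (runs-block₂ (a + k) m) (sym (runs-block₂ x y)) ,
    maximizer-if-dominates (block (suc x) (suc y) 0) (block (suc a) (suc m) k) (block (suc a + k) (suc m) 0)
      merged-len b-max (c-merge-trailing (suc x) y (suc a) (suc m) k)
    where
    merged-len : length (block (suc a + k) (suc m) 0) ≡ n
    merged-len = begin
      length (block (suc a + k) (suc m) 0)  ≡⟨ length-block (suc a + k) (suc m) 0 ⟩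
      suc a + k + suc m + 0                 ≡⟨ solve (a ∷ k ∷ m ∷ []) ⟩
      suc a + suc m + k                     ≡⟨ sym (length-block (suc a) (suc m) k) ⟩
      length (block (suc a) (suc m) k)      ≡⟨ b-len ⟩
      n                                     ∎
      where open ≡-Reasoning
  maximizer x y (suc z) n p≤n with block-maximizer (suc x) y (suc z) n p≤n
  ... | suc a , suc m , suc k , b-len , b-max , s≤s _ , s≤s _ , s≤s _ =
    block (suc a) (suc m) (suc k) , b-len , trans (runs-block₃ a m k) (sym (runs-block₃ x y z)) , b-max

mainTheorem8 : (p : Word) → 1 ≤ length p → runs p ≤ 3 → (n : ℕ) → length p ≤ n →
    Σ Word (λ w → (length w ≡ n) × (runs w ≡ runs p) × (c p w ≡ M n p))
mainTheorem8 p 0<length runs≤3 n p≤n with atMostThreeRuns p 0<length runs≤3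
... | one-run a x           = one-run-maximizer a x n p≤n
... | two-letters o≢i x y z = TwoLetters.maximizer o≢i x y z n p≤n
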